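{- Let $m,n$ be integers with $3\leq m\leq n$. Then $$\chi_{lid}(C_m \square C_n)=\begin{cases}5 & \text{if } m=3,\\ 3 & \text{if } m \text{ and } n \text{ are both even},\\ 4 & \text{otherwise}.\end{cases}$$
   Context: $C_m$ denotes the cycle on $m$ vertices. A proper $k$-coloring of a graph $G$ is a map $f:V(G)\to\{1,\dots,k\}$ with $f(u)\neq f(v)$ for every edge $uv$. For a vertex $v$, $N[v]$ denotes its closed neighborhood, and $f(S)=\{f(x):x\in S\}$. A lid-coloring of $G$ is a proper coloring $f$ such that for every edge $uv$ with $N[u]\neq N[v]$ we have $f(N[u])\neq f(N[v])$; $\chi_{lid}(G)$ is the smallest number of colors in a lid-coloring of $G$. The Cartesian product $G\square H$ has vertex set $V(G)\times V(H)$, where $(u_1,v_1)$ and $(u_2,v_2)$ are adjacent iff either $u_1=u_2$ and $v_1v_2\in E(H)$, or $v_1=v_2$ and $u_1u_2\in E(G)$. -}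

module Defs where

open import Data.Nat using (ℕ; zero; suc; _<_)
open import Data.Fin using (Fin; toℕ)
open import Data.Product using (Σ; ∃; _×_; _,_)
open import Data.Sum using (_⊎_)
open import Relation.Nullary using (¬_)
open import Relation.Binary.PropositionalEquality using (_≡_; _≢_)
open import Function.Bundles using (_⇔_)
open import Level using (0ℓ)

record Graph : Set₁ where
  field
    V   : Set
    Adj : V → V → Set
open Graph public

CycleAdj : (m : ℕ) → Fin m → Fin m → Set
CycleAdj m i j =
  (suc (toℕ i) ≡ toℕ j) ⊎ (suc (toℕ j) ≡ toℕ i)
  ⊎ ((toℕ i ≡ 0 × suc (toℕ j) ≡ m) ⊎ (toℕ j ≡ 0 × suc (toℕ i) ≡ m))

Cycle : ℕ → Graph
Cycle m = record { V = Fin m ; Adj = CycleAdj m }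

_□_ : Graph → Graph → Graph
G □ H = record
  { V = V G × V H
  ; Adj = λ { (u₁ , v₁) (u₂ , v₂) →
        (u₁ ≡ u₂ × Adj H v₁ v₂) ⊎ (v₁ ≡ v₂ × Adj G u₁ u₂) } }

InN : (G : Graph) → V G → V G → Set
InN G u x = (x ≡ u) ⊎ Adj G u x

SameN : (G : Graph) → V G → V G → Set
SameN G u v = ∀ x → (InN G u x ⇔ InN G v x)

InColN : (G : Graph) {k : ℕ} → (V G → Fin k) → V G → Fin k → Set
InColN G f u c = ∃ λ x → InN G u x × f x ≡ c

SameColN : (G : Graph) {k : ℕ} → (V G → Fin k) → V G → V G → Set
SameColN G f u v = ∀ c → (InColN G f u c ⇔ InColN G f v c)

IsProper : (G : Graph) {k : ℕ} → (V G → Fin k) → Set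
IsProper G f = ∀ u v → Adj G u v → f u ≢ f v

IsLidColoring : (G : Graph) {k : ℕ} → (V G → Fin k) → Set
IsLidColoring G f =
  IsProper G f ×
  (∀ u v → Adj G u v → ¬ SameN G u v → ¬ SameColN G f u v)

χlid≡ : Graph → ℕ → Set
χlid≡ G k =
  (Σ (V G → Fin k) (IsLidColoring G)) ×
  (∀ j → j < k → ¬ Σ (V G → Fin j) (IsLidColoring G))

-- The colourings are products f (i , j) = g (α i) (β j) of a small palette g with labellings
-- α, β of the two cycles by a few labels. Whether such an f is a lid-colouring depends only on
-- four consecutive labels in each direction, so it is settled by checking finitely many pairs of
-- windows.
-- For the lower bounds, the colour set of N[u] contains the colours of every edge at u. With two
-- colours these sets are therefore everything. With three colours, adjacent vertices that are
-- both full or both not full see the same colours, so fullness alternates around a cycle, which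
-- is impossible on an odd one. In C₃ □ Cₙ with four colours, each vertex of a triangle sees the
-- triangle's three colours and at most the fourth, so two of the three see the same colours.
module Submission where

open import Defs
open import Data.Nat as ℕ using (ℕ; zero; suc; _+_; _∸_; _≤_; _<_; z≤n; s≤s)
open import Data.Nat.Divisibility using (_∣_; divides)
open import Data.Nat.Properties
  using ( +-suc; +-identityʳ; *-comm; suc-injective; 1+n≢n; n<1+n; n≤1+n; <-irrefl; <-cmp
        ; <-trans; ≤-<-trans; ≤-trans; ≤-antisym; ≤-pred; ≤∧≢⇒<)
open import Data.Fin as Fin using (Fin; zero; suc; toℕ; fromℕ<; inject≤; #_)
open import Data.Fin.Properties
  using (toℕ-fromℕ<; toℕ-injective; toℕ<n; pigeonhole; inject≤-injective; ¬∀⟶∃¬; any?; all?)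
open import Data.Bool using (Bool; not)
open import Data.Bool.Properties using (¬-not; not-¬; not-involutive; not-injective)
open import Data.Vec using (Vec; []; _∷_; lookup)
open import Data.List using (List; []; _∷_; map; _++_)
open import Data.List.Relation.Unary.Any as Any using (here; there)
open import Data.List.Membership.Propositional using (_∈_; _∉_; find)
open import Data.List.Relation.Binary.Subset.Propositional using (_⊆_)
open import Data.List.Relation.Unary.Any using (Any)
open import Data.List.Relation.Unary.All as All using (All)
open import Data.List.Membership.Propositional.Properties
  using (∈-map⁺; ∈-map⁻; ∈-++⁺ˡ; ∈-++⁺ʳ)
open import Data.Product.Properties using (≡-dec)
open import Data.Product using (Σ; ∃; ∃₂; _×_; _,_; proj₁; proj₂)
open import Data.Sum using (_⊎_; inj₁; inj₂; [_,_]′)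
open import Data.Empty using (⊥; ⊥-elim)
open import Data.Unit using (tt)
open import Level using (0ℓ)
open import Relation.Unary using (Pred; Decidable)
open import Relation.Binary using (tri<; tri≈; tri>)
open import Relation.Nullary using (¬_; Dec; yes; no; does; ¬?; contradiction)
open import Relation.Nullary.Decidable using (map′; _×-dec_; _⊎-dec_; toWitness; True)
open import Relation.Binary.PropositionalEquality
open import Function using (_∘_; id)
open import Function.Bundles using (_⇔_; Equivalence; mk⇔)
open import Function.Definitions using (Injective)
open import Function.Properties.Equivalence using () renaming (sym to ⇔-sym)

module _ {k : ℕ} (a : Fin k → Fin (suc k)) where

  Outside : Fin (suc k) → Set
  Outside x = ∀ i → a i ≢ x

  HasOutsider : Pred (Fin (suc k)) 0ℓ → Set
  HasOutsider S = ∃ λ c → S c × Outside c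

  module _ (a-injective : Injective _≡_ _≡_ a) where

    outside-unique : ∀ {x y} → Outside x → Outside y → x ≡ y
    outside-unique {x} {y} x-out y-out =
      let i , j , i<j , e = pigeonhole (n<1+n (suc k)) table in collision i j i<j e
      where
      table : Fin (suc (suc k)) → Fin (suc k)
      table zero = x
      table (suc zero) = y
      table (suc (suc i)) = a i
      collision : ∀ i j → i Fin.< j → table i ≡ table j → x ≡ y
      collision zero (suc zero) _ e = e
      collision zero (suc (suc j)) _ e = ⊥-elim (x-out j (sym e))
      collision (suc zero) (suc (suc j)) _ e = ⊥-elim (y-out j (sym e))
      collision (suc (suc i)) (suc (suc j)) (s≤s (s≤s i<j)) e =
        ⊥-elim (<-irrefl (cong toℕ (a-injective e)) i<j)
      collision (suc zero) (suc zero) (s≤s ())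

    ⊆-of-outsiders : (S T : Pred (Fin (suc k)) 0ℓ) → (∀ i → T (a i)) →
      (HasOutsider S → HasOutsider T) → ∀ c → S c → T c
    ⊆-of-outsiders S T a∈T transfer c c∈S with any? (λ i → a i Fin.≟ c)
    ... | yes (i , refl) = a∈T i
    ... | no c∉a =
      let d , d∈T , d-out = transfer (c , c∈S , λ i e → c∉a (i , e))
      in subst T (outside-unique d-out (λ i e → c∉a (i , e))) d∈T

    ¬∀⇒¬HasOutsider : (S : Pred (Fin (suc k)) 0ℓ) → Decidable S → (∀ i → S (a i)) →
      ¬ (∀ c → S c) → ¬ HasOutsider S
    ¬∀⇒¬HasOutsider S S? a∈S not-full (c , c∈S , c-out) =
      let w , w∉S = ¬∀⟶∃¬ _ S S? not-full
      in w∉S (subst S (outside-unique c-out (λ i e → w∉S (subst S e (a∈S i)))) c∈S)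

pair-injective : ∀ {k} {x y : Fin k} → x ≢ y → Injective _≡_ _≡_ (lookup (x ∷ y ∷ []))
pair-injective x≢y {zero} {zero} _ = refl
pair-injective x≢y {zero} {suc zero} e = ⊥-elim (x≢y e)
pair-injective x≢y {suc zero} {zero} e = ⊥-elim (x≢y (sym e))
pair-injective x≢y {suc zero} {suc zero} _ = refl

singleton-injective : ∀ {k} {c : Fin k} → Injective _≡_ _≡_ (lookup (c ∷ []))
singleton-injective {x = zero} {y = zero} _ = refl

does-≡⇒ : ∀ {P Q : Set} (p? : Dec P) (q? : Dec Q) → does p? ≡ does q? → Q ⊎ ¬ P
does-≡⇒ _ (yes q) _ = inj₁ q
does-≡⇒ (no ¬p) (no _) _ = inj₂ ¬p
does-≡⇒ (yes _) (no _) ()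

Bool-pigeonhole : (B : Fin 3 → Bool) → ∃₂ λ i j → i ≢ j × B i ≡ B j
Bool-pigeonhole B with B zero Data.Bool.≟ B (suc zero) | B zero Data.Bool.≟ B (suc (suc zero))
... | yes e | _ = zero , suc zero , (λ ()) , e
... | no _ | yes e = zero , suc (suc zero) , (λ ()) , e
... | no ne₁ | no ne₂ =
  suc zero , suc (suc zero) , (λ ()) , not-injective (trans (sym (¬-not ne₁)) (¬-not ne₂))

alternating-odd : (B : ℕ → Bool) → (∀ i → B (suc i) ≢ B i) → ∀ q → B (suc (q + q)) ≢ B 0
alternating-odd B alternates q closed = not-¬ (sym (even q)) (trans (sym closed) (step (q + q)))
  where
  step : ∀ i → B (suc i) ≡ not (B i)
  step i = ¬-not (alternates i)
  even : ∀ q → B (q + q) ≡ B 0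
  even zero = refl
  even (suc q) rewrite +-suc q q =
    trans (step (suc (q + q))) (trans (cong not (step (q + q))) (trans (not-involutive _) (even q)))

module _ (G : Graph) where

  recolour-lid : ∀ {j k} {h : Fin j → Fin k} → Injective _≡_ _≡_ h →
    ∀ {f : V G → Fin j} → IsLidColoring G f → IsLidColoring G (h ∘ f)
  recolour-lid {h = h} h-injective {f} (proper , distinguishes) =
    (λ u v uv e → proper u v uv (h-injective e)) ,
    (λ u v uv N≠ same → distinguishes u v uv N≠ λ c → mk⇔
      (pull v ∘ Equivalence.to (same (h c)) ∘ push u)
      (pull u ∘ Equivalence.from (same (h c)) ∘ push v))
    where
    push : ∀ w {c} → InColN G f w c → InColN G (h ∘ f) w (h c)
    push w (x , x∈N , refl) = x , x∈N , refl
    pull : ∀ w {c} → InColN G (h ∘ f) w (h c) → InColN G f w c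
    pull w (x , x∈N , e) = x , x∈N , h-injective e

  no-lid-fewer : ∀ {K} → ¬ Σ (V G → Fin K) (IsLidColoring G) →
    ∀ j → j < suc K → ¬ Σ (V G → Fin j) (IsLidColoring G)
  no-lid-fewer no-lid j j≤K (f , lid) =
    no-lid ((λ c → inject≤ c (≤-pred j≤K)) ∘ f ,
            recolour-lid (inject≤-injective (≤-pred j≤K) (≤-pred j≤K) _ _) lid)

  module _ {k : ℕ} (f : V G → Fin k) where

    own-colour : ∀ u → InColN G f u (f u)
    own-colour u = u , inj₁ refl , refl

    neighbour-colour : ∀ {u v} → Adj G u v → InColN G f u (f v)
    neighbour-colour {v = v} uv = v , inj₂ uv , refl

module _ (G : Graph) (adj-sym : ∀ {u v} → Adj G u v → Adj G v u) where

  two-colour-⊆ : (f : V G → Fin 2) → ∀ {u v} → Adj G u v → f u ≢ f v →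
    ∀ c → InColN G f u c → InColN G f v c
  two-colour-⊆ f {u} {v} uv fu≢fv =
    ⊆-of-outsiders (lookup (f u ∷ [])) singleton-injective (InColN G f u) (InColN G f v)
      (λ { zero → neighbour-colour G f (adj-sym uv) })
      (λ _ → f v , own-colour G f v , λ { zero → fu≢fv })

  no-lid-2 : ∀ {u v} → Adj G u v → ¬ SameN G u v → ¬ Σ (V G → Fin 2) (IsLidColoring G)
  no-lid-2 {u} {v} uv N≠ (f , proper , distinguishes) =
    distinguishes u v uv N≠ λ c → mk⇔
      (two-colour-⊆ f uv (proper u v uv) c)
      (two-colour-⊆ f (adj-sym uv) (proper u v uv ∘ sym) c)

  module _ (InColN? : ∀ {k} (f : V G → Fin k) u → Decidable (InColN G f u)) where

    Full : ∀ {k} → (V G → Fin k) → V G → Set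
    Full f u = ∀ c → InColN G f u c

    full? : ∀ {k} (f : V G → Fin k) u → Dec (Full f u)
    full? f u = all? (InColN? f u)

    three-colour-⊆ : (f : V G → Fin 3) → ∀ {u v} → Adj G u v → f u ≢ f v →
      Full f v ⊎ ¬ Full f u → ∀ c → InColN G f u c → InColN G f v c
    three-colour-⊆ f uv _ (inj₁ v-full) c _ = v-full c
    three-colour-⊆ f {u} {v} uv fu≢fv (inj₂ u-not-full) =
      ⊆-of-outsiders a (pair-injective fu≢fv) (InColN G f u) (InColN G f v)
        (λ { zero → neighbour-colour G f (adj-sym uv) ; (suc zero) → own-colour G f v })
        (λ outsider → ⊥-elim (¬∀⇒¬HasOutsider a (pair-injective fu≢fv) (InColN G f u)
                                (InColN? f u) a∈u u-not-full outsider))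
      where
      a : Fin 2 → Fin 3
      a = lookup (f u ∷ f v ∷ [])
      a∈u : ∀ i → InColN G f u (a i)
      a∈u zero = own-colour G f u
      a∈u (suc zero) = neighbour-colour G f uv

    no-lid-3-odd-walk : (p : ℕ → V G) → (∀ i → Adj G (p i) (p (suc i))) →
      (∀ i → ¬ SameN G (p i) (p (suc i))) → ∀ q → p (suc (q + q)) ≡ p 0 →
      ¬ Σ (V G → Fin 3) (IsLidColoring G)
    no-lid-3-odd-walk p walk N≠ q closed (f , proper , distinguishes) =
      alternating-odd (full-flag ∘ p) alternates q (cong full-flag closed)
      where
      full-flag : V G → Bool
      full-flag u = does (full? f u)
      alternates : ∀ i → full-flag (p (suc i)) ≢ full-flag (p i)
      alternates i e = distinguishes _ _ (walk i) (N≠ i) λ c → mk⇔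
        (three-colour-⊆ f (walk i) (proper _ _ (walk i))
           (does-≡⇒ (full? f (p i)) (full? f (p (suc i))) (sym e)) c)
        (three-colour-⊆ f (adj-sym (walk i)) (proper _ _ (walk i) ∘ sym)
           (does-≡⇒ (full? f (p (suc i))) (full? f (p i)) e) c)

    no-lid-4-triangle : (t : Fin 3 → V G) → (∀ {i j} → i ≢ j → Adj G (t i) (t j)) →
      (∀ {i j} → i ≢ j → ¬ SameN G (t i) (t j)) → ¬ Σ (V G → Fin 4) (IsLidColoring G)
    no-lid-4-triangle t adj N≠ (f , proper , distinguishes) =
      let i , j , i≢j , e = Bool-pigeonhole U
      in distinguishes _ _ (adj i≢j) (N≠ i≢j) λ c → mk⇔ (⊆-of-same-U e c) (⊆-of-same-U (sym e) c)
      where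
      a : Fin 3 → Fin 4
      a = f ∘ t
      a-injective : Injective _≡_ _≡_ a
      a-injective {i} {j} e with i Fin.≟ j
      ... | yes i≡j = i≡j
      ... | no i≢j = ⊥-elim (proper _ _ (adj i≢j) e)
      a∈ : ∀ i j → InColN G f (t i) (a j)
      a∈ i j with j Fin.≟ i
      ... | yes refl = own-colour G f (t i)
      ... | no j≢i = neighbour-colour G f (adj (j≢i ∘ sym))
      outsider? : ∀ i → Dec (HasOutsider a (InColN G f (t i)))
      outsider? i = any? λ c → InColN? f (t i) c ×-dec all? (λ j → ¬? (a j Fin.≟ c))
      U : Fin 3 → Bool
      U i = does (outsider? i)
      ⊆-of-same-U : ∀ {i j} → U i ≡ U j → ∀ c → InColN G f (t i) c → InColN G f (t j) c
      ⊆-of-same-U {i} {j} e = ⊆-of-outsiders a a-injective _ _ (a∈ j)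
        λ outsider → [ id , contradiction outsider ]′ (does-≡⇒ (outsider? i) (outsider? j) e)

nextℕ : ℕ → ℕ → ℕ
nextℕ N i with suc i ℕ.≟ N
... | yes _ = 0
... | no _ = suc i

prevℕ : ℕ → ℕ → ℕ
prevℕ N zero = N ∸ 1
prevℕ N (suc i) = i

nextℕ-< : ∀ {N i} → suc i < N → nextℕ N i ≡ suc i
nextℕ-< {N} {i} i+1<N with suc i ℕ.≟ N
... | yes i+1≡N = ⊥-elim (<-irrefl i+1≡N i+1<N)
... | no _ = refl

nextℕ-last : ∀ {N i} → suc i ≡ N → nextℕ N i ≡ 0
nextℕ-last {N} {i} i+1≡N with suc i ℕ.≟ N
... | yes _ = refl
... | no i+1≢N = ⊥-elim (i+1≢N i+1≡N)

nextℕ<N : ∀ {N i} → i < N → nextℕ N i < N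
nextℕ<N {N} {i} i<N with suc i ℕ.≟ N
... | yes _ = ≤-<-trans z≤n i<N
... | no i+1≢N = ≤∧≢⇒< i<N i+1≢N

prevℕ<N : ∀ {N i} → i < N → prevℕ N i < N
prevℕ<N {suc N} {zero} _ = n<1+n N
prevℕ<N {N} {suc i} i<N = <-trans (n<1+n i) i<N

prevℕ-nextℕ : ∀ {N i} → i < N → prevℕ N (nextℕ N i) ≡ i
prevℕ-nextℕ {N} {i} _ with suc i ℕ.≟ N
... | yes refl = refl
... | no _ = refl

nextℕ-prevℕ : ∀ {N i} → i < N → nextℕ N (prevℕ N i) ≡ i
nextℕ-prevℕ {suc N} {zero} _ = nextℕ-last refl
nextℕ-prevℕ {N} {suc i} i<N = nextℕ-< i<N

next : ∀ {N} → Fin N → Fin N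
next i = fromℕ< (nextℕ<N (toℕ<n i))

prev : ∀ {N} → Fin N → Fin N
prev i = fromℕ< (prevℕ<N (toℕ<n i))

toℕ-next : ∀ {N} (i : Fin N) → toℕ (next i) ≡ nextℕ N (toℕ i)
toℕ-next i = toℕ-fromℕ< _

toℕ-prev : ∀ {N} (i : Fin N) → toℕ (prev i) ≡ prevℕ N (toℕ i)
toℕ-prev i = toℕ-fromℕ< _

prev-next : ∀ {N} (i : Fin N) → prev (next i) ≡ i
prev-next {N} i = toℕ-injective (begin
  toℕ (prev (next i))       ≡⟨ toℕ-prev (next i) ⟩
  prevℕ N (toℕ (next i))    ≡⟨ cong (prevℕ N) (toℕ-next i) ⟩
  prevℕ N (nextℕ N (toℕ i)) ≡⟨ prevℕ-nextℕ (toℕ<n i) ⟩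
  toℕ i                     ∎)
  where open ≡-Reasoning

next-prev : ∀ {N} (i : Fin N) → next (prev i) ≡ i
next-prev {N} i = toℕ-injective (begin
  toℕ (next (prev i))       ≡⟨ toℕ-next (prev i) ⟩
  nextℕ N (toℕ (prev i))    ≡⟨ cong (nextℕ N) (toℕ-prev i) ⟩
  nextℕ N (prevℕ N (toℕ i)) ≡⟨ nextℕ-prevℕ (toℕ<n i) ⟩
  toℕ i                     ∎)
  where open ≡-Reasoning

next≢ : ∀ {N} → 2 ≤ N → (i : Fin N) → next i ≢ i
next≢ {N} 2≤N i next≡i with suc (toℕ i) ℕ.≟ N | toℕ-next i
... | yes i+1≡N | t = <-irrefl (trans (sym (cong suc (trans (sym (cong toℕ next≡i)) t))) i+1≡N) 2≤N
... | no _      | t = 1+n≢n (trans (sym t) (cong toℕ next≡i))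

module _ {N : ℕ} where

  suc⇒≡next : {i j : Fin N} → suc (toℕ i) ≡ toℕ j → j ≡ next i
  suc⇒≡next {i} {j} i+1≡j = toℕ-injective (begin
    toℕ j              ≡⟨ sym i+1≡j ⟩
    suc (toℕ i)        ≡⟨ sym (nextℕ-< (subst (_< N) (sym i+1≡j) (toℕ<n j))) ⟩
    nextℕ N (toℕ i)    ≡⟨ sym (toℕ-next i) ⟩
    toℕ (next i)       ∎)
    where open ≡-Reasoning

  wrap⇒≡next : {i j : Fin N} → toℕ j ≡ 0 → suc (toℕ i) ≡ N → j ≡ next i
  wrap⇒≡next {i} j≡0 i+1≡N =
    toℕ-injective (trans j≡0 (sym (trans (toℕ-next i) (nextℕ-last i+1≡N))))

  CycleAdj⇒≡next : {i j : Fin N} → CycleAdj N i j → j ≡ next i ⊎ i ≡ next j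
  CycleAdj⇒≡next (inj₁ e) = inj₁ (suc⇒≡next e)
  CycleAdj⇒≡next (inj₂ (inj₁ e)) = inj₂ (suc⇒≡next e)
  CycleAdj⇒≡next (inj₂ (inj₂ (inj₁ (i≡0 , j+1≡N)))) = inj₂ (wrap⇒≡next i≡0 j+1≡N)
  CycleAdj⇒≡next (inj₂ (inj₂ (inj₂ (j≡0 , i+1≡N)))) = inj₁ (wrap⇒≡next j≡0 i+1≡N)

  CycleAdj-sym : {i j : Fin N} → CycleAdj N i j → CycleAdj N j i
  CycleAdj-sym (inj₁ e) = inj₂ (inj₁ e)
  CycleAdj-sym (inj₂ (inj₁ e)) = inj₁ e
  CycleAdj-sym (inj₂ (inj₂ (inj₁ e))) = inj₂ (inj₂ (inj₂ e))
  CycleAdj-sym (inj₂ (inj₂ (inj₂ e))) = inj₂ (inj₂ (inj₁ e))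

  CycleAdj-next : (i : Fin N) → CycleAdj N i (next i)
  CycleAdj-next i with suc (toℕ i) ℕ.≟ N | toℕ-next i
  ... | yes i+1≡N | t = inj₂ (inj₂ (inj₂ (t , i+1≡N)))
  ... | no _      | t = inj₁ (sym t)

  CycleAdj-prev : (i : Fin N) → CycleAdj N i (prev i)
  CycleAdj-prev i = CycleAdj-sym (subst (CycleAdj N (prev i)) (next-prev i) (CycleAdj-next (prev i)))

CycleAdj-complete₃ : {i j : Fin 3} → i ≢ j → CycleAdj 3 i j
CycleAdj-complete₃ {zero} {zero} i≢j = ⊥-elim (i≢j refl)
CycleAdj-complete₃ {zero} {suc zero} _ = inj₁ refl
CycleAdj-complete₃ {zero} {suc (suc zero)} _ = inj₂ (inj₂ (inj₁ (refl , refl)))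
CycleAdj-complete₃ {suc zero} {zero} _ = inj₂ (inj₁ refl)
CycleAdj-complete₃ {suc zero} {suc zero} i≢j = ⊥-elim (i≢j refl)
CycleAdj-complete₃ {suc zero} {suc (suc zero)} _ = inj₁ refl
CycleAdj-complete₃ {suc (suc zero)} {zero} _ = inj₂ (inj₂ (inj₂ (refl , refl)))
CycleAdj-complete₃ {suc (suc zero)} {suc zero} _ = inj₂ (inj₁ refl)
CycleAdj-complete₃ {suc (suc zero)} {suc (suc zero)} i≢j = ⊥-elim (i≢j refl)

module _ {N : ℕ} where
  open import Function.Endo.Propositional (Fin (suc N)) using (_^_)

  around : ℕ → Fin (suc N)
  around i = (next ^ i) zero

  toℕ-around : ∀ i → i < suc N → toℕ (around i) ≡ i
  toℕ-around zero _ = refl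
  toℕ-around (suc i) i+1<N = begin
    toℕ (next (around i))          ≡⟨ toℕ-next (around i) ⟩
    nextℕ (suc N) (toℕ (around i)) ≡⟨ cong (nextℕ (suc N)) (toℕ-around i (<-trans (n<1+n i) i+1<N)) ⟩
    nextℕ (suc N) i                ≡⟨ nextℕ-< i+1<N ⟩
    suc i                          ∎
    where open ≡-Reasoning

  around-closes : around (suc N) ≡ zero
  around-closes = toℕ-injective (begin
    toℕ (next (around N))          ≡⟨ toℕ-next (around N) ⟩
    nextℕ (suc N) (toℕ (around N)) ≡⟨ cong (nextℕ (suc N)) (toℕ-around N (n<1+n N)) ⟩
    nextℕ (suc N) N                ≡⟨ nextℕ-last refl ⟩
    0                              ∎)
    where open ≡-Reasoning

Odd : ℕ → Set
Odd N = ∃ λ q → N ≡ suc (q + q)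

Window : Set
Window = ℕ × ℕ × ℕ × ℕ

-- The labels at i - 1, i, i + 1 and i + 2: in a product colouring they determine the colours
-- seen from (i , j), (i + 1 , j) and (i , j + 1).
window : ∀ {N} → (Fin N → ℕ) → Fin N → Window
window s i = s (prev i) , s i , s (next i) , s (next (next i))

open import Data.List.Membership.DecPropositional (≡-dec ℕ._≟_ (≡-dec ℕ._≟_ (≡-dec ℕ._≟_ ℕ._≟_)))
  using () renaming (_∈?_ to _∈ʷ?_)

∈-by-computation : {w : Window} {W : List Window} → True (w ∈ʷ? W) → w ∈ W
∈-by-computation = toWitness

Labelling : ℕ → List Window → Set
Labelling N W = Σ (Fin N → ℕ) λ s → ∀ i → window s i ∈ W

module _ {k : ℕ} where

  Separated : List (Fin k) → List (Fin k) → Set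
  Separated L M = Any (_∉ M) L ⊎ Any (_∉ L) M

  separated? : ∀ L M → Dec (Separated L M)
  separated? L M = Any.any? (λ c → ¬? (c ∈? M)) L ⊎-dec Any.any? (λ c → ¬? (c ∈? L)) M
    where open import Data.List.Membership.DecPropositional (Fin._≟_ {k}) using (_∈?_)

  separated⇒¬⊆⊇ : ∀ {L M} → Separated L M → L ⊆ M → M ⊆ L → ⊥
  separated⇒¬⊆⊇ (inj₁ some) L⊆M _ = let c , c∈L , c∉M = find some in c∉M (L⊆M c∈L)
  separated⇒¬⊆⊇ (inj₂ some) _ M⊆L = let c , c∈M , c∉L = find some in c∉L (M⊆L c∈M)

module _ {k : ℕ} (g : ℕ → ℕ → Fin k) where

  centre-colours right-colours up-colours : Window → Window → List (Fin k)
  centre-colours (a₀ , a₁ , a₂ , _)  (b₀ , b₁ , b₂ , _)  = g a₁ b₁ ∷ g a₁ b₂ ∷ g a₁ b₀ ∷ g a₂ b₁ ∷ g a₀ b₁ ∷ []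
  right-colours  (_  , a₁ , a₂ , a₃) (b₀ , b₁ , b₂ , _)  = g a₂ b₁ ∷ g a₂ b₂ ∷ g a₂ b₀ ∷ g a₃ b₁ ∷ g a₁ b₁ ∷ []
  up-colours     (a₀ , a₁ , a₂ , _)  (_  , b₁ , b₂ , b₃) = g a₁ b₂ ∷ g a₁ b₃ ∷ g a₁ b₁ ∷ g a₂ b₂ ∷ g a₀ b₂ ∷ []

  LocallyLid : Window → Window → Set
  LocallyLid a@(_ , a₁ , a₂ , _) b@(_ , b₁ , b₂ , _) =
    g a₁ b₁ ≢ g a₂ b₁ × g a₁ b₁ ≢ g a₁ b₂ ×
    Separated (centre-colours a b) (right-colours a b) × Separated (centre-colours a b) (up-colours a b)

  locallyLid? : ∀ a b → Dec (LocallyLid a b)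
  locallyLid? a@(_ , a₁ , a₂ , _) b@(_ , b₁ , b₂ , _) =
    ¬? (g a₁ b₁ Fin.≟ g a₂ b₁) ×-dec ¬? (g a₁ b₁ Fin.≟ g a₁ b₂) ×-dec
    separated? (centre-colours a b) (right-colours a b) ×-dec separated? (centre-colours a b) (up-colours a b)

  all-locallyLid? : ∀ WA WB → Dec (All (λ a → All (LocallyLid a) WB) WA)
  all-locallyLid? WA WB = All.all? (λ a → All.all? (locallyLid? a) WB) WA

module Torus (m n : ℕ) where

  T : Graph
  T = Cycle m □ Cycle n

  Cell : Set
  Cell = Fin m × Fin n

  right up : Cell → Cell
  right (i , j) = next i , j
  up (i , j) = i , next j

  adj-sym : ∀ {u v} → Adj T u v → Adj T v u
  adj-sym (inj₁ (i≡i′ , jj′)) = inj₁ (sym i≡i′ , CycleAdj-sym jj′)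
  adj-sym (inj₂ (j≡j′ , ii′)) = inj₂ (sym j≡j′ , CycleAdj-sym ii′)

  adj-right : ∀ u → Adj T u (right u)
  adj-right (i , j) = inj₂ (refl , CycleAdj-next i)

  adj-up : ∀ u → Adj T u (up u)
  adj-up (i , j) = inj₁ (refl , CycleAdj-next j)

  edge-induction : (P : Cell → Cell → Set) → (∀ {u v} → P u v → P v u) →
    (∀ u → P u (right u)) → (∀ u → P u (up u)) → ∀ u v → Adj T u v → P u v
  edge-induction P P-sym P-right P-up (i , j) (_ , j′) (inj₁ (refl , jj′)) with CycleAdj⇒≡next jj′
  ... | inj₁ refl = P-up (i , j)
  ... | inj₂ refl = P-sym (P-up (i , j′))
  edge-induction P P-sym P-right P-up (i , j) (i′ , _) (inj₂ (refl , ii′)) with CycleAdj⇒≡next ii′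
  ... | inj₁ refl = P-right (i , j)
  ... | inj₂ refl = P-sym (P-right (i′ , j))

  closed-nbhd : Cell → List Cell
  closed-nbhd (i , j) = (i , j) ∷ (i , next j) ∷ (i , prev j) ∷ (next i , j) ∷ (prev i , j) ∷ []

  InN⇒∈closed-nbhd : ∀ {u x} → InN T u x → x ∈ closed-nbhd u
  InN⇒∈closed-nbhd (inj₁ refl) = here refl
  InN⇒∈closed-nbhd {i , j} (inj₂ (inj₁ (refl , jj′))) with CycleAdj⇒≡next jj′
  ... | inj₁ refl = there (here refl)
  ... | inj₂ refl = there (there (here (cong (i ,_) (sym (prev-next _)))))
  InN⇒∈closed-nbhd {i , j} (inj₂ (inj₂ (refl , ii′))) with CycleAdj⇒≡next ii′
  ... | inj₁ refl = there (there (there (here refl)))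
  ... | inj₂ refl = there (there (there (there (here (cong (_, j) (sym (prev-next _)))))))

  ∈closed-nbhd⇒InN : ∀ {u x} → x ∈ closed-nbhd u → InN T u x
  ∈closed-nbhd⇒InN (here refl) = inj₁ refl
  ∈closed-nbhd⇒InN {i , j} (there (here refl)) = inj₂ (inj₁ (refl , CycleAdj-next j))
  ∈closed-nbhd⇒InN {i , j} (there (there (here refl))) = inj₂ (inj₁ (refl , CycleAdj-prev j))
  ∈closed-nbhd⇒InN {i , j} (there (there (there (here refl)))) = inj₂ (inj₂ (refl , CycleAdj-next i))
  ∈closed-nbhd⇒InN {i , j} (there (there (there (there (here refl))))) =
    inj₂ (inj₂ (refl , CycleAdj-prev i))

  module _ {k : ℕ} (f : Cell → Fin k) where

    colours : Cell → List (Fin k)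
    colours u = map f (closed-nbhd u)

    InColN⇒∈colours : ∀ {u c} → InColN T f u c → c ∈ colours u
    InColN⇒∈colours (x , x∈N , refl) = ∈-map⁺ f (InN⇒∈closed-nbhd x∈N)

    ∈colours⇒InColN : ∀ {u c} → c ∈ colours u → InColN T f u c
    ∈colours⇒InColN c∈ =
      let x , x∈N , c≡fx = ∈-map⁻ f c∈ in x , ∈closed-nbhd⇒InN x∈N , sym c≡fx

    InColN? : ∀ u → Decidable (InColN T f u)
    InColN? u c = map′ ∈colours⇒InColN InColN⇒∈colours (Any.any? (c Fin.≟_) (colours u))

    SameColN⇒⊆ : ∀ {u v} → SameColN T f u v → colours u ⊆ colours v
    SameColN⇒⊆ same c∈ = InColN⇒∈colours (Equivalence.to (same _) (∈colours⇒InColN c∈))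

    separated⇒¬SameColN : ∀ {u v} → Separated (colours u) (colours v) → ¬ SameColN T f u v
    separated⇒¬SameColN separated same =
      separated⇒¬⊆⊇ separated (SameColN⇒⊆ same) (SameColN⇒⊆ (⇔-sym ∘ same))

  adjacent-N≢ : 2 ≤ m → 2 ≤ n → ∀ u v → Adj T u v → ¬ SameN T u v
  adjacent-N≢ 2≤m 2≤n = edge-induction (λ u v → ¬ SameN T u v)
    (λ N≢ same → N≢ λ x → ⇔-sym (same x)) right-N≢ up-N≢
    where
    right-N≢ : ∀ u → ¬ SameN T u (right u)
    right-N≢ (i , j) same with Equivalence.to (same (i , next j)) (inj₂ (inj₁ (refl , CycleAdj-next j)))
    ... | inj₁ e = next≢ 2≤m i (sym (cong proj₁ e))
    ... | inj₂ (inj₁ (e , _)) = next≢ 2≤m i e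
    ... | inj₂ (inj₂ (e , _)) = next≢ 2≤n j (sym e)
    up-N≢ : ∀ u → ¬ SameN T u (up u)
    up-N≢ (i , j) same with Equivalence.to (same (next i , j)) (inj₂ (inj₂ (refl , CycleAdj-next i)))
    ... | inj₁ e = next≢ 2≤m i (cong proj₁ e)
    ... | inj₂ (inj₁ (e , _)) = next≢ 2≤m i (sym e)
    ... | inj₂ (inj₂ (e , _)) = next≢ 2≤n j e

  torus-no-lid-2 : 2 ≤ m → 2 ≤ n → ¬ Σ (Cell → Fin 2) (IsLidColoring T)
  torus-no-lid-2 2≤m@(s≤s _) 2≤n@(s≤s _) =
    no-lid-2 T adj-sym (adj-up (zero , zero)) (adjacent-N≢ 2≤m 2≤n _ _ (adj-up (zero , zero)))

  torus-no-lid-3 : 2 ≤ m → 2 ≤ n → Odd m ⊎ Odd n → ¬ Σ (Cell → Fin 3) (IsLidColoring T)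
  torus-no-lid-3 2≤m 2≤n@(s≤s _) (inj₁ (q , refl)) =
    no-lid-3-odd-walk T adj-sym InColN? (λ i → around i , zero) (λ _ → adj-right _)
      (λ _ → adjacent-N≢ 2≤m 2≤n _ _ (adj-right _)) q (cong (_, zero) around-closes)
  torus-no-lid-3 2≤m@(s≤s _) 2≤n (inj₂ (q , refl)) =
    no-lid-3-odd-walk T adj-sym InColN? (λ i → zero , around i) (λ _ → adj-up _)
      (λ _ → adjacent-N≢ 2≤m 2≤n _ _ (adj-up _)) q (cong (zero ,_) around-closes)

  torus-no-lid-4 : m ≡ 3 → 2 ≤ n → ¬ Σ (Cell → Fin 4) (IsLidColoring T)
  torus-no-lid-4 refl 2≤n@(s≤s _) =
    no-lid-4-triangle T adj-sym InColN? (_, zero) triangle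
      (λ i≢j → adjacent-N≢ (s≤s (s≤s z≤n)) 2≤n _ _ (triangle i≢j))
    where
    triangle : ∀ {i j} → i ≢ j → Adj T (i , zero) (j , zero)
    triangle i≢j = inj₂ (refl , CycleAdj-complete₃ i≢j)

  module ProductColouring {k} (g : ℕ → ℕ → Fin k) (α : Fin m → ℕ) (β : Fin n → ℕ)
    (local : ∀ i j → LocallyLid g (window α i) (window β j)) where

    f : Cell → Fin k
    f (i , j) = g (α i) (β j)

    colours-right : ∀ i j → colours f (next i , j) ≡ right-colours g (window α i) (window β j)
    colours-right i j rewrite prev-next i = refl

    colours-up : ∀ i j → colours f (i , next j) ≡ up-colours g (window α i) (window β j)
    colours-up i j rewrite prev-next j = refl

    ¬same-right : ∀ u → ¬ SameColN T f u (right u)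
    ¬same-right (i , j) =
      let _ , _ , separated , _ = local i j
      in separated⇒¬SameColN f (subst (Separated (colours f (i , j))) (sym (colours-right i j)) separated)

    ¬same-up : ∀ u → ¬ SameColN T f u (up u)
    ¬same-up (i , j) =
      let _ , _ , _ , separated = local i j
      in separated⇒¬SameColN f (subst (Separated (colours f (i , j))) (sym (colours-up i j)) separated)

    product-lid : IsLidColoring T f
    product-lid =
      edge-induction (λ u v → f u ≢ f v) (_∘ sym)
        (λ (i , j) → proj₁ (local i j)) (λ (i , j) → proj₁ (proj₂ (local i j))) ,
      λ u v uv _ → edge-induction (λ u v → ¬ SameColN T f u v) (λ ¬same → ¬same ∘ (⇔-sym ∘_))
        ¬same-right ¬same-up u v uv

  lid-from-labellings : ∀ {k} (g : ℕ → ℕ → Fin k) {WA WB} → Labelling m WA → Labelling n WB →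
    All (λ a → All (LocallyLid g a) WB) WA → Σ (Cell → Fin k) (IsLidColoring T)
  lid-from-labellings g (α , α-windows) (β , β-windows) checked =
    ProductColouring.f g α β local , ProductColouring.product-lid g α β local
    where
    local : ∀ i j → LocallyLid g (window α i) (window β j)
    local i j = All.lookup (All.lookup checked (α-windows i)) (β-windows j)

windowℕ : ℕ → (ℕ → ℕ) → ℕ → Window
windowℕ N s i = s (prevℕ N i) , s i , s (nextℕ N i) , s (nextℕ N (nextℕ N i))

window-toℕ : ∀ {N} (s : ℕ → ℕ) (i : Fin N) → window (s ∘ toℕ) i ≡ windowℕ N s (toℕ i)
window-toℕ s i rewrite toℕ-prev i | toℕ-next (next i) | toℕ-next i = refl

labelling : ∀ {N W} (s : ℕ → ℕ) → (∀ i → i < N → windowℕ N s i ∈ W) → Labelling N W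
labelling s windows =
  s ∘ toℕ , λ i → subst (_∈ _) (sym (window-toℕ s i)) (windows (toℕ i) (toℕ<n i))

Labelling-≡ : ∀ {N N′ W} → N ≡ N′ → Labelling N′ W → Labelling N W
Labelling-≡ refl ℓ = ℓ

Labelling-⊆ : ∀ {N W W′} → W ⊆ W′ → Labelling N W → Labelling N W′
Labelling-⊆ W⊆W′ (s , windows) = s , W⊆W′ ∘ windows

data WindowShape (N : ℕ) (s : ℕ → ℕ) (i : ℕ) : Set where
  wraps-left : windowℕ N s i ≡ (s (N ∸ 1) , s 0 , s 1 , s 2) → WindowShape N s i
  inside : ∀ k → 3 + k < N →
    windowℕ N s i ≡ (s k , s (1 + k) , s (2 + k) , s (3 + k)) → WindowShape N s i
  wraps-right-by-1 : ∀ k → 3 + k ≡ N →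
    windowℕ N s i ≡ (s k , s (1 + k) , s (2 + k) , s 0) → WindowShape N s i
  wraps-right-by-2 : ∀ k → 2 + k ≡ N →
    windowℕ N s i ≡ (s k , s (1 + k) , s 0 , s 1) → WindowShape N s i

windowℕ-≡ : ∀ {N} {s : ℕ → ℕ} {i a b} → nextℕ N i ≡ a → nextℕ N a ≡ b →
  windowℕ N s i ≡ (s (prevℕ N i) , s i , s a , s b)
windowℕ-≡ refl refl = refl

window-shape : ∀ {N} (s : ℕ → ℕ) {i} → 3 ≤ N → i < N → WindowShape N s i
window-shape s {zero} 3≤N _ =
  wraps-left (windowℕ-≡ {s = s} (nextℕ-< (≤-trans (s≤s (s≤s z≤n)) 3≤N)) (nextℕ-< 3≤N))
window-shape {N} s {suc k} 3≤N k+1<N with <-cmp (3 + k) N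
... | tri< k+3<N _ _ =
  inside k k+3<N (windowℕ-≡ {s = s} (nextℕ-< (<-trans (n<1+n _) k+3<N)) (nextℕ-< k+3<N))
... | tri≈ _ k+3≡N _ =
  wraps-right-by-1 k k+3≡N
    (windowℕ-≡ {s = s} (nextℕ-< (subst (2 + k <_) k+3≡N (n<1+n _))) (nextℕ-last k+3≡N))
... | tri> _ _ k+3>N =
  let k+2≡N = ≤-antisym k+1<N (≤-pred k+3>N)
  in wraps-right-by-2 k k+2≡N
       (windowℕ-≡ {s = s} (nextℕ-last k+2≡N) (nextℕ-< (≤-trans (s≤s (s≤s z≤n)) 3≤N)))

alternating : ℕ → ℕ
alternating zero = 0
alternating (suc zero) = 1
alternating (suc (suc i)) = alternating i

alternating-double : ∀ r → alternating (r + r) ≡ 0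
alternating-double zero = refl
alternating-double (suc r) rewrite +-suc r r = alternating-double r

alternating-double+1 : ∀ r → alternating (suc (r + r)) ≡ 1
alternating-double+1 zero = refl
alternating-double+1 (suc r) rewrite +-suc r r = alternating-double+1 r

alternating-windows : List Window
alternating-windows = (0 , 1 , 0 , 1) ∷ (1 , 0 , 1 , 0) ∷ []

alternating-inside : ∀ k →
  (alternating k , alternating (1 + k) , alternating (2 + k) , alternating (3 + k)) ∈ alternating-windows
alternating-inside zero = ∈-by-computation tt
alternating-inside (suc zero) = ∈-by-computation tt
alternating-inside (suc (suc k)) = alternating-inside k

alternating-window∈ : ∀ r i → i < 4 + (r + r) →
  windowℕ (4 + (r + r)) alternating i ∈ alternating-windows
alternating-window∈ r i i<N with window-shape alternating (s≤s (s≤s (s≤s z≤n))) i<N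
... | wraps-left e rewrite e | alternating-double+1 r = ∈-by-computation tt
... | inside k _ e rewrite e = alternating-inside k
... | wraps-right-by-1 k k+3≡N e rewrite e | suc-injective (suc-injective (suc-injective k+3≡N))
  | alternating-double r | alternating-double+1 r = ∈-by-computation tt
... | wraps-right-by-2 k k+2≡N e rewrite e | suc-injective (suc-injective k+2≡N)
  | alternating-double r | alternating-double+1 r = ∈-by-computation tt

alternating-labelling : ∀ r → Labelling (4 + (r + r)) alternating-windows
alternating-labelling r = labelling alternating (alternating-window∈ r)

-- The cyclic word (01)ᵖ234 of length 2p + 3.
odd-word : ℕ → ℕ → ℕ
odd-word zero i = 2 + i
odd-word (suc p) zero = 0
odd-word (suc p) (suc zero) = 1
odd-word (suc p) (suc (suc i)) = odd-word p i

odd-word-tail : ∀ p i → odd-word p (i + (p + p)) ≡ 2 + i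
odd-word-tail zero i rewrite +-identityʳ i = refl
odd-word-tail (suc p) i rewrite +-suc p p | +-suc i (suc (p + p)) | +-suc i (p + p) = odd-word-tail p i

triangle-windows long-windows : List Window
triangle-windows = (4 , 2 , 3 , 4) ∷ (2 , 3 , 4 , 2) ∷ (3 , 4 , 2 , 3) ∷ []
long-windows = alternating-windows ++
  (0 , 1 , 2 , 3) ∷ (1 , 0 , 1 , 2) ∷ (1 , 2 , 3 , 4) ∷ (2 , 3 , 4 , 0) ∷ (3 , 4 , 0 , 1) ∷
  (4 , 0 , 1 , 0) ∷ (4 , 0 , 1 , 2) ∷ []

odd-windows : ℕ → List Window
odd-windows zero = triangle-windows
odd-windows (suc _) = long-windows

odd-word-inside : ∀ p k → 3 + k < 3 + (p + p) →
  (odd-word p k , odd-word p (1 + k) , odd-word p (2 + k) , odd-word p (3 + k)) ∈ odd-windows p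
odd-word-inside zero k (s≤s (s≤s (s≤s ())))
odd-word-inside (suc zero) zero _ = ∈-by-computation tt
odd-word-inside (suc (suc p)) zero _ = ∈-by-computation tt
odd-word-inside (suc zero) (suc zero) _ = ∈-by-computation tt
odd-word-inside (suc (suc zero)) (suc zero) _ = ∈-by-computation tt
odd-word-inside (suc (suc (suc p))) (suc zero) _ = ∈-by-computation tt
odd-word-inside (suc zero) (suc (suc k)) (s≤s (s≤s (s≤s (s≤s (s≤s ())))))
odd-word-inside (suc (suc p)) (suc (suc k)) k+5<N = odd-word-inside (suc p) k k+3<N
  where
  k+3<N : 3 + k < 3 + (suc p + suc p)
  k+3<N = subst (4 + k ≤_) (cong (3 +_) (+-suc p (suc p))) (≤-pred (≤-pred k+5<N))

odd-word-window∈ : ∀ p i → i < 3 + (p + p) → windowℕ (3 + (p + p)) (odd-word p) i ∈ odd-windows p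
odd-word-window∈ p i i<N with window-shape (odd-word p) (s≤s (s≤s (s≤s z≤n))) i<N
odd-word-window∈ zero _ _ | wraps-left e rewrite e = ∈-by-computation tt
odd-word-window∈ (suc zero) _ _ | wraps-left e rewrite e = ∈-by-computation tt
odd-word-window∈ (suc (suc p)) _ _ | wraps-left e
  rewrite e | +-suc p (suc p) | +-suc p p | odd-word-tail p 2 = ∈-by-computation tt
odd-word-window∈ p _ _ | inside k k+3<N e rewrite e = odd-word-inside p k k+3<N
odd-word-window∈ zero _ _ | wraps-right-by-1 k k+3≡N e
  rewrite e | suc-injective (suc-injective (suc-injective k+3≡N)) = ∈-by-computation tt
odd-word-window∈ (suc p) _ _ | wraps-right-by-1 k k+3≡N e
  rewrite e | suc-injective (suc-injective (suc-injective k+3≡N))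
        | odd-word-tail (suc p) 0 | odd-word-tail (suc p) 1 | odd-word-tail (suc p) 2 = ∈-by-computation tt
odd-word-window∈ zero _ _ | wraps-right-by-2 k k+2≡N e
  rewrite e | suc-injective (suc-injective k+2≡N) = ∈-by-computation tt
odd-word-window∈ (suc p) _ _ | wraps-right-by-2 k k+2≡N e
  rewrite e | suc-injective (suc-injective k+2≡N)
        | odd-word-tail (suc p) 1 | odd-word-tail (suc p) 2 = ∈-by-computation tt

odd-labelling : ∀ p → Labelling (3 + (p + p)) (odd-windows p)
odd-labelling p = labelling (odd-word p) (odd-word-window∈ p)

double-suc² : ∀ r → suc (suc r) + suc (suc r) ≡ 4 + (r + r)
double-suc² r = cong (2 +_) (trans (+-suc r (suc r)) (cong suc (+-suc r r)))

double-suc+1 : ∀ p → suc (suc p + suc p) ≡ 3 + (p + p)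
double-suc+1 p = cong (2 +_) (+-suc p p)

parity : ∀ N → (∃ λ q → N ≡ q + q) ⊎ Odd N
parity zero = inj₁ (0 , refl)
parity (suc N) with parity N
... | inj₁ (q , refl) = inj₂ (q , refl)
... | inj₂ (q , refl) = inj₁ (suc q , cong suc (sym (+-suc q q)))

2∣⇒double : ∀ {N} → 2 ∣ N → ∃ λ q → N ≡ q + q
2∣⇒double (divides q refl) = q , trans (*-comm q 2) (cong (q +_) (+-identityʳ q))

double⇒2∣ : ∀ {N} q → N ≡ q + q → 2 ∣ N
double⇒2∣ q refl = divides q (trans (cong (q +_) (sym (+-identityʳ q))) (*-comm 2 q))

odd-if-not-both-even : ∀ {m n} → ¬ (2 ∣ m × 2 ∣ n) → Odd m ⊎ Odd n
odd-if-not-both-even {m} {n} not-both with parity m | parity n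
... | inj₂ m-odd | _ = inj₁ m-odd
... | inj₁ _ | inj₂ n-odd = inj₂ n-odd
... | inj₁ (q , m≡q+q) | inj₁ (q′ , n≡q′+q′) =
  ⊥-elim (not-both (double⇒2∣ q m≡q+q , double⇒2∣ q′ n≡q′+q′))

even-labelling : ∀ {N} → 3 ≤ N → 2 ∣ N → Labelling N alternating-windows
even-labelling 3≤N 2∣N with 2∣⇒double 2∣N
even-labelling () _ | zero , refl
even-labelling (s≤s (s≤s ())) _ | suc zero , refl
even-labelling _ _ | suc (suc r) , refl =
  Labelling-≡ (double-suc² r) (alternating-labelling r)

long-labelling : ∀ {N} → 4 ≤ N → Labelling N long-windows
long-labelling {N} 4≤N with parity N
long-labelling () | inj₁ (zero , refl)
long-labelling (s≤s (s≤s ())) | inj₁ (suc zero , refl)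
long-labelling _ | inj₁ (suc (suc r) , refl) =
  Labelling-≡ (double-suc² r) (Labelling-⊆ ∈-++⁺ˡ (alternating-labelling r))
long-labelling (s≤s ()) | inj₂ (zero , refl)
long-labelling (s≤s (s≤s (s≤s ()))) | inj₂ (suc zero , refl)
long-labelling _ | inj₂ (suc (suc p) , refl) =
  Labelling-≡ (double-suc+1 (suc p)) (odd-labelling (suc p))

any-labelling : ∀ {N} → 3 ≤ N → Labelling N (triangle-windows ++ long-windows)
any-labelling {N} 3≤N with parity N
any-labelling () | inj₁ (zero , refl)
any-labelling (s≤s (s≤s ())) | inj₁ (suc zero , refl)
any-labelling _ | inj₁ (suc (suc r) , refl) = Labelling-≡ (double-suc² r)
  (Labelling-⊆ (∈-++⁺ʳ triangle-windows ∘ ∈-++⁺ˡ) (alternating-labelling r))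
any-labelling (s≤s ()) | inj₂ (zero , refl)
any-labelling _ | inj₂ (suc zero , refl) = Labelling-≡ (double-suc+1 0)
  (Labelling-⊆ ∈-++⁺ˡ (odd-labelling 0))
any-labelling _ | inj₂ (suc (suc p) , refl) = Labelling-≡ (double-suc+1 (suc p))
  (Labelling-⊆ (∈-++⁺ʳ triangle-windows) (odd-labelling (suc p)))

palette₃ : ℕ → ℕ → Fin 3
palette₃ 0 0 = # 0
palette₃ 0 1 = # 1
palette₃ 1 0 = # 1
palette₃ 1 1 = # 2
palette₃ _ _ = # 0

palette₄ : ℕ → ℕ → Fin 4
palette₄ 0 0 = # 0
palette₄ 0 1 = # 1
palette₄ 0 2 = # 2
palette₄ 0 3 = # 3
palette₄ 0 4 = # 2
palette₄ 1 0 = # 2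
palette₄ 1 1 = # 3
palette₄ 1 2 = # 1
palette₄ 1 3 = # 0
palette₄ 1 4 = # 1
palette₄ 2 0 = # 1
palette₄ 2 1 = # 2
palette₄ 2 2 = # 0
palette₄ 2 3 = # 1
palette₄ 2 4 = # 2
palette₄ 3 0 = # 3
palette₄ 3 1 = # 0
palette₄ 3 2 = # 2
palette₄ 3 3 = # 3
palette₄ 3 4 = # 1
palette₄ 4 0 = # 1
palette₄ 4 1 = # 2
palette₄ 4 2 = # 1
palette₄ 4 3 = # 2
palette₄ 4 4 = # 0
palette₄ _ _ = # 0

palette₅ : ℕ → ℕ → Fin 5
palette₅ 2 0 = # 0
palette₅ 2 1 = # 1
palette₅ 2 2 = # 0
palette₅ 2 3 = # 1
palette₅ 2 4 = # 2
palette₅ 3 0 = # 1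
palette₅ 3 1 = # 2
palette₅ 3 2 = # 1
palette₅ 3 3 = # 2
palette₅ 3 4 = # 3
palette₅ 4 0 = # 4
palette₅ 4 1 = # 3
palette₅ 4 2 = # 4
palette₅ 4 3 = # 0
palette₅ 4 4 = # 1
palette₅ _ _ = # 0

palette₃-locallyLid : All (λ a → All (LocallyLid palette₃ a) alternating-windows) alternating-windows
palette₃-locallyLid = toWitness {a? = all-locallyLid? palette₃ _ _} tt

palette₄-locallyLid : All (λ a → All (LocallyLid palette₄ a) long-windows) long-windows
palette₄-locallyLid = toWitness {a? = all-locallyLid? palette₄ _ _} tt

palette₅-locallyLid :
  All (λ a → All (LocallyLid palette₅ a) (triangle-windows ++ long-windows)) triangle-windows
palette₅-locallyLid = toWitness {a? = all-locallyLid? palette₅ _ _} tt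

χlid-C₃□Cₙ : ∀ {n} → 3 ≤ n → χlid≡ (Cycle 3 □ Cycle n) 5
χlid-C₃□Cₙ {n} 3≤n =
  lid-from-labellings palette₅ (odd-labelling 0) (any-labelling 3≤n) palette₅-locallyLid ,
  no-lid-fewer T (torus-no-lid-4 refl (≤-trans (n≤1+n 2) 3≤n))
  where open Torus 3 n

χlid-even : ∀ {m n} → 3 ≤ m → 3 ≤ n → 2 ∣ m → 2 ∣ n → χlid≡ (Cycle m □ Cycle n) 3
χlid-even {m} {n} 3≤m 3≤n 2∣m 2∣n =
  lid-from-labellings palette₃ (even-labelling 3≤m 2∣m) (even-labelling 3≤n 2∣n) palette₃-locallyLid ,
  no-lid-fewer T (torus-no-lid-2 (≤-trans (n≤1+n 2) 3≤m) (≤-trans (n≤1+n 2) 3≤n))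
  where open Torus m n

χlid-odd : ∀ {m n} → 4 ≤ m → 4 ≤ n → Odd m ⊎ Odd n → χlid≡ (Cycle m □ Cycle n) 4
χlid-odd {m} {n} 4≤m 4≤n odd =
  lid-from-labellings palette₄ (long-labelling 4≤m) (long-labelling 4≤n) palette₄-locallyLid ,
  no-lid-fewer T (torus-no-lid-3 (≤-trans (s≤s (s≤s z≤n)) 4≤m) (≤-trans (s≤s (s≤s z≤n)) 4≤n) odd)
  where open Torus m n

theorem6 : (m n : ℕ) → 3 ≤ m → m ≤ n →
    (m ≡ 3 → χlid≡ (Cycle m □ Cycle n) 5) ×
    (2 ∣ m → 2 ∣ n → χlid≡ (Cycle m □ Cycle n) 3) ×
    (m ≢ 3 → ¬ (2 ∣ m × 2 ∣ n) → χlid≡ (Cycle m □ Cycle n) 4)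
theorem6 m n 3≤m m≤n =
  (λ { refl → χlid-C₃□Cₙ 3≤n }) ,
  χlid-even 3≤m 3≤n ,
  λ m≢3 not-both-even →
    let 4≤m = ≤∧≢⇒< 3≤m (m≢3 ∘ sym)
    in χlid-odd 4≤m (≤-trans 4≤m m≤n) (odd-if-not-both-even not-both-even)
  where
  3≤n : 3 ≤ n
  3≤n = ≤-trans 3≤m m≤n
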